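{- $\chi\left(\mathbb{E}^2,\left\{1,\sqrt{3/2+\sqrt{33}/6}\right\}\right)\ge 5$.
   Context: For a set $\mathcal{D}\subseteq(0,\infty)$, the distance graph $G(\mathbb{E}^2,\mathcal{D})$ has as vertices all points of the Euclidean plane $\mathbb{E}^2$, two points $x,y$ being adjacent iff $\|x-y\|\in\mathcal{D}$ (Euclidean norm). $\chi(\mathbb{E}^2,\mathcal{D})$ denotes its chromatic number, i.e. the least $k$ such that the plane can be colored with $k$ colors with no two points at a distance belonging to $\mathcal{D}$ receiving the same color. -}

module Defs where

open import Level using (0ℓ)
open import Data.Nat using (ℕ; zero; suc; _<_)
open import Data.Fin using (Fin)
open import Data.Product using (Σ; _×_; _,_; ∃)
open import Data.Sum using (_⊎_)
open import Relation.Nullary using (¬_)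
open import Relation.Binary.PropositionalEquality using (_≡_; _≢_)
open import Algebra.Structures using (IsCommutativeRing)

-- An axiomatisation of the real numbers: a complete ordered field
-- (any two models are isomorphic, so quantifying over all models is
-- the same as speaking about "the" reals).
record RealNumbers : Set₁ where
  infixl 6 _+_ _-_
  infixl 7 _*_
  infix 4 _≤_
  field
    ℝ : Set
    _+_ _*_ : ℝ → ℝ → ℝ
    -_ : ℝ → ℝ
    0ℝ 1ℝ : ℝ
    isCommutativeRing : IsCommutativeRing _≡_ _+_ _*_ -_ 0ℝ 1ℝ
    0≢1 : 0ℝ ≢ 1ℝ
    inverse : ∀ x → x ≢ 0ℝ → ∃ λ y → x * y ≡ 1ℝ
    _≤_ : ℝ → ℝ → Set
    ≤-refl : ∀ x → x ≤ x
    ≤-antisym : ∀ {x y} → x ≤ y → y ≤ x → x ≡ y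
    ≤-trans : ∀ {x y z} → x ≤ y → y ≤ z → x ≤ z
    ≤-total : ∀ x y → x ≤ y ⊎ y ≤ x
    +-mono-≤ : ∀ {x y} z → x ≤ y → x + z ≤ y + z
    *-nonneg : ∀ {x y} → 0ℝ ≤ x → 0ℝ ≤ y → 0ℝ ≤ x * y
    completeness : (P : ℝ → Set) → ∃ P →
                   (∃ λ b → ∀ x → P x → x ≤ b) →
                   ∃ λ s → (∀ x → P x → x ≤ s) ×
                           (∀ b → (∀ x → P x → x ≤ b) → s ≤ b)

  _-_ : ℝ → ℝ → ℝ
  x - y = x + (- y)

  fromℕ : ℕ → ℝ
  fromℕ zero = 0ℝ
  fromℕ (suc n) = 1ℝ + fromℕ n

  E² : Set
  E² = ℝ × ℝ

  _dist_≡_ : E² → E² → ℝ → Set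
  (x₁ , x₂) dist (y₁ , y₂) ≡ d =
    0ℝ ≤ d × d * d ≡ (x₁ - y₁) * (x₁ - y₁) + (x₂ - y₂) * (x₂ - y₂)

  Adjacent : (ℝ → Set) → E² → E² → Set
  Adjacent D p q = ∃ λ d → D d × p dist q ≡ d

  ProperColouring : (ℝ → Set) → ℕ → Set
  ProperColouring D k =
    Σ (E² → Fin k) λ c → ∀ p q → Adjacent D p q → c p ≢ c q

  χ≥ : (ℝ → Set) → ℕ → Set
  χ≥ D m = ∀ k → k < m → ¬ ProperColouring D k

-- A colouring with at most four colours must give the same colour to any two
-- points at distance 2. Indeed, there is a 22-vertex graph whose edges have lengths 1 and t,
-- realised in the plane with coordinates in Q(√3, √11), in which two vertices at distance 2
-- cannot be coloured differently: adding the edge between them leaves a graph that an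
-- exhaustive backtracking search shows not to be 4-colourable. Every segment of length 2 is
-- the image of that pair under a rigid motion, and rigid motions preserve both distances.
-- But an isosceles triangle with sides 2, 2 and 1 then has its two base vertices, at distance
-- 1, coloured alike.

module Submission where

open import Defs
open import Level using (0ℓ)
open import Algebra.Bundles using (CommutativeRing; RawRing)
open import Algebra.Solver.Ring.AlmostCommutativeRing
  using (AlmostCommutativeRing; fromCommutativeRing; _-Raw-AlmostCommutative⟶_)
import Algebra.Solver.Ring
open import Data.Bool using (Bool; T; true; false; not; _∧_; _∨_)
open import Data.Bool.ListAction using (all)
open import Data.Fin as Fin using (Fin)
open import Data.Fin.Properties using (inject≤-injective)
open import Data.Integer as ℤ using (ℤ; -[1+_]; _⊖_)
import Data.Integer.Properties as ℤ
open import Data.List using (List; []; _∷_; map; allFin)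
open import Data.List.Membership.Propositional.Properties using (∈-allFin)
open import Data.List.Relation.Unary.All as All using (All; []; _∷_)
open import Data.List.Relation.Unary.All.Properties using (all⁺; all⁻; map⁺)
import Data.Maybe as Maybe
open import Data.Nat as ℕ using (ℕ; zero; suc)
import Data.Nat.Properties as ℕ
open import Data.List.Membership.DecPropositional ℕ._≟_ using (_∈?_)
open import Data.Product using (Σ; _×_; _,_; proj₁; proj₂; ∃)
open import Data.Product.Properties using (≡-dec)
open import Data.Sum using (_⊎_; inj₁; inj₂; [_,_]′)
open import Data.Empty using (⊥)
open import Data.Unit using (⊤; tt)
open import Function using (_∘_)
open import Relation.Binary.Definitions using (DecidableEquality)
open import Relation.Binary.PropositionalEquality
open import Relation.Nullary using (¬_; Dec; yes; no)
open import Relation.Nullary.Decidable using (⌊_⌋; decidable-stable; from-yes; _×-dec_; dec⇒maybe)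

-- Colouring certificates

-- Row i of a graph lists the neighbours j < i of vertex i.
Graph : Set
Graph = List (List ℕ)

addEdge : ℕ → ℕ → Graph → Graph
addEdge _ _ [] = []
addEdge zero j (ns ∷ nss) = (j ∷ ns) ∷ nss
addEdge (suc i) j (ns ∷ nss) = ns ∷ addEdge i j nss

Assignment : ℕ → Set
Assignment k = List (ℕ × Fin k)

conflicts : ∀ {k} → List ℕ → Fin k → ℕ × Fin k → Bool
conflicts ns c (j , d) = ⌊ d Fin.≟ c ⌋ ∧ ⌊ j ∈? ns ⌋

admissible : ∀ {k} → Assignment k → List ℕ → Fin k → Bool
admissible σ ns c = all (not ∘ conflicts ns c) σ

uncolourable : ∀ {k} → ℕ → Assignment k → Graph → Bool
uncolourable i σ [] = false
uncolourable {k} i σ (ns ∷ nss) =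
  all (λ c → not (admissible σ ns c) ∨ uncolourable (suc i) ((i , c) ∷ σ) nss) (allFin k)

module Colouring {k : ℕ} (f : ℕ → Fin k) where

  Proper : ℕ → Graph → Set
  Proper i [] = ⊤
  Proper i (ns ∷ nss) = All (λ j → f i ≢ f j) ns × Proper (suc i) nss

  Proper-addEdge : ∀ m i j G → Proper m G → f (m ℕ.+ i) ≢ f j → Proper m (addEdge i j G)
  Proper-addEdge m i j [] _ _ = tt
  Proper-addEdge m zero j (ns ∷ nss) (proper , rest) fi≢fj rewrite ℕ.+-identityʳ m = (fi≢fj ∷ proper) , rest
  Proper-addEdge m (suc i) j (ns ∷ nss) (proper , rest) fi≢fj =
    proper , Proper-addEdge (suc m) i j nss rest (subst (λ v → f v ≢ f j) (ℕ.+-suc m i) fi≢fj)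

  Agrees : Assignment k → Set
  Agrees = All (λ (j , c) → f j ≡ c)

  admissible-proper : ∀ {i ns} σ → Agrees σ → All (λ j → f i ≢ f j) ns → T (admissible σ ns (f i))
  admissible-proper {i} {ns} σ agrees proper = all⁻ _ (All.map no-conflict agrees)
    where
    no-conflict : ∀ {(j , d) : ℕ × Fin k} → f j ≡ d → T (not (conflicts ns (f i) (j , d)))
    no-conflict {j , d} refl with d Fin.≟ f i | j ∈? ns
    ... | yes fj≡fi | yes j∈ns = All.lookup proper j∈ns (sym fj≡fi)
    ... | yes _     | no _     = _
    ... | no _      | _        = _

  uncolourable-sound : ∀ i σ G → Agrees σ → T (uncolourable i σ G) → ¬ Proper i G
  uncolourable-sound i σ (ns ∷ nss) agrees certificate (proper , rest) =
    uncolourable-sound (suc i) _ nss (refl ∷ agrees) (modus-ponens try-f-i (admissible-proper σ agrees proper)) rest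
    where
    try-f-i : T (not (admissible σ ns (f i)) ∨ uncolourable (suc i) ((i , f i) ∷ σ) nss)
    try-f-i = All.lookup (all⁺ _ (allFin k) certificate) (∈-allFin (f i))
    modus-ponens : ∀ {a b} → T (not a ∨ b) → T a → T b
    modus-ponens {true} b _ = b

  uncolourable-addEdge⇒sameColour : ∀ i j G → uncolourable 0 [] (addEdge i j G) ≡ true → Proper 0 G → f i ≡ f j
  uncolourable-addEdge⇒sameColour i j G certificate proper =
    decidable-stable (f i Fin.≟ f j) λ fi≢fj →
      uncolourable-sound 0 [] (addEdge i j G) [] (subst T (sym certificate) _) (Proper-addEdge 0 i j G proper fi≢fj)

EdgesSatisfy : {L : Set} → (ℕ → ℕ → L → Set) → ℕ → List (List (ℕ × L)) → Set
EdgesSatisfy P i [] = ⊤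
EdgesSatisfy P i (ns ∷ nss) = All (λ (j , ℓ) → P i j ℓ) ns × EdgesSatisfy P (suc i) nss

edgesSatisfy? : {L : Set} {P : ℕ → ℕ → L → Set} → (∀ i j ℓ → Dec (P i j ℓ)) →
                ∀ i G → Dec (EdgesSatisfy P i G)
edgesSatisfy? P? i [] = yes tt
edgesSatisfy? P? i (ns ∷ nss) = All.all? (λ (j , ℓ) → P? i j ℓ) ns ×-dec edgesSatisfy? P? (suc i) nss

EdgesSatisfy⇒Proper : ∀ {k} (f : ℕ → Fin k) {L : Set} {P : ℕ → ℕ → L → Set} →
                      (∀ i j ℓ → P i j ℓ → f i ≢ f j) →
                      ∀ i G → EdgesSatisfy P i G → Colouring.Proper f i (map (map proj₁) G)
EdgesSatisfy⇒Proper f P⇒≢ i [] _ = tt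
EdgesSatisfy⇒Proper f P⇒≢ i (ns ∷ nss) (ps , pss) =
  map⁺ (All.map (P⇒≢ i _ _) ps) , EdgesSatisfy⇒Proper f P⇒≢ (suc i) nss pss

-- Exact arithmetic in ℤ[√3, √11]

adjoinRoot : (K : RawRing 0ℓ 0ℓ) → RawRing.Carrier K → RawRing 0ℓ 0ℓ
adjoinRoot K d = record
  { Carrier = Carrier × Carrier
  ; _≈_ = _≡_
  ; _+_ = λ (a , b) (a′ , b′) → (a + a′ , b + b′)
  ; _*_ = λ (a , b) (a′ , b′) → (a * a′ + d * (b * b′) , a * b′ + b * a′)
  ; -_ = λ (a , b) → (- a , - b)
  ; 0# = 0# , 0#
  ; 1# = 1# , 0#
  }
  where open RawRing K

ℤ[√3] : RawRing 0ℓ 0ℓ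
ℤ[√3] = adjoinRoot ℤ.+-*-rawRing (ℤ.+ 3)

ℤ[√3,√11] : RawRing 0ℓ 0ℓ
ℤ[√3,√11] = adjoinRoot ℤ[√3] (ℤ.+ 11 , ℤ.+ 0)

Coordinate : Set
Coordinate = (ℤ × ℤ) × (ℤ × ℤ)

_≟ᶜ_ : DecidableEquality Coordinate
_≟ᶜ_ = ≡-dec (≡-dec ℤ._≟_ ℤ._≟_) (≡-dec ℤ._≟_ ℤ._≟_)

module Plane (R : RawRing 0ℓ 0ℓ) where
  open RawRing R

  sqDist : Carrier × Carrier → Carrier × Carrier → Carrier
  sqDist (x₁ , x₂) (y₁ , y₂) = (x₁ + - y₁) * (x₁ + - y₁) + (x₂ + - y₂) * (x₂ + - y₂)

-- The gadget

data Length : Set where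
  unit long : Length

gadgetEdges : List (List (ℕ × Length))
gadgetEdges =
    []
  ∷ ((0 , long) ∷ [])
  ∷ ((0 , unit) ∷ (1 , unit) ∷ [])
  ∷ ((1 , unit) ∷ (2 , unit) ∷ [])
  ∷ ((0 , unit) ∷ (2 , unit) ∷ (3 , long) ∷ [])
  ∷ ((1 , unit) ∷ (3 , long) ∷ (4 , long) ∷ [])
  ∷ ((1 , unit) ∷ (2 , long) ∷ (5 , unit) ∷ [])
  ∷ ((2 , long) ∷ (3 , unit) ∷ (6 , long) ∷ [])
  ∷ ((0 , unit) ∷ (5 , unit) ∷ (7 , unit) ∷ [])
  ∷ ((4 , unit) ∷ (6 , long) ∷ (8 , unit) ∷ [])
  ∷ ((1 , long) ∷ (3 , unit) ∷ (8 , unit) ∷ (9 , unit) ∷ [])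
  ∷ ((2 , unit) ∷ (3 , long) ∷ (8 , unit) ∷ (9 , unit) ∷ [])
  ∷ ((1 , long) ∷ (2 , unit) ∷ (10 , long) ∷ (11 , unit) ∷ [])
  ∷ ((5 , unit) ∷ (7 , unit) ∷ (8 , unit) ∷ (12 , long) ∷ [])
  ∷ ((1 , unit) ∷ (3 , long) ∷ (11 , long) ∷ (13 , unit) ∷ [])
  ∷ ((3 , unit) ∷ (10 , unit) ∷ (12 , unit) ∷ (13 , unit) ∷ [])
  ∷ ((3 , unit) ∷ (6 , unit) ∷ (7 , unit) ∷ (9 , unit) ∷ [])
  ∷ ((9 , unit) ∷ (13 , unit) ∷ (15 , unit) ∷ (16 , unit) ∷ [])
  ∷ ((1 , unit) ∷ (2 , long) ∷ (8 , unit) ∷ (14 , unit) ∷ [])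
  ∷ ((2 , long) ∷ (3 , unit) ∷ (10 , unit) ∷ (18 , long) ∷ [])
  ∷ ((0 , unit) ∷ (7 , unit) ∷ (8 , unit) ∷ (14 , long) ∷ (19 , unit) ∷ [])
  ∷ ((5 , unit) ∷ (9 , unit) ∷ (17 , unit) ∷ [])
  ∷ []

gadget : Graph
gadget = map (map proj₁) gadgetEdges

gadget-forces : uncolourable {4} 0 [] (addEdge 21 1 gadget) ≡ true
gadget-forces = refl

module Positions where
  open import Agda.Builtin.FromNat using (fromNat)
  import Data.Integer.Literals as ℤ-Literals

  private instance
    ℤ-number = ℤ-Literals.number
    ℤ-negative = ℤ-Literals.negative
    unit-instance = tt

  -- Vertex i is the point (x / 12 , y / 12) with position i = (x , y), and
  -- ((a , b) , (c , d)) stands for a + b√3 + (c + d√3)√11; vertex 21 is the origin.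
  position : ℕ → Coordinate × Coordinate
  position 0  = ((28 , 0) , (0 , 0)) , ((0 , -6) , (2 , 0))
  position 1  = ((20 , 0) , (0 , 0)) , ((0 , 0) , (4 , 0))
  position 2  = ((23 , 0) , (0 , -1)) , ((0 , -1) , (1 , 0))
  position 3  = ((23 , 0) , (0 , 1)) , ((0 , 1) , (1 , 0))
  position 4  = ((18 , 0) , (0 , 0)) , ((0 , -6) , (0 , 0))
  position 5  = ((10 , 0) , (0 , 0)) , ((0 , 0) , (2 , 0))
  position 6  = ((15 , 0) , (0 , -1)) , ((0 , 5) , (3 , 0))
  position 7  = ((28 , 0) , (0 , 0)) , ((0 , 6) , (2 , 0))
  position 8  = ((22 , 0) , (0 , 0)) , ((0 , 0) , (2 , 0))
  position 9  = ((12 , 0) , (0 , 0)) , ((0 , 0) , (0 , 0))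
  position 10 = ((17 , 0) , (0 , 1)) , ((0 , -5) , (1 , 0))
  position 11 = ((17 , 0) , (0 , -1)) , ((0 , 5) , (1 , 0))
  position 12 = ((11 , 0) , (0 , -1)) , ((0 , -1) , (1 , 0))
  position 13 = ((16 , 0) , (0 , 0)) , ((0 , 6) , (2 , 0))
  position 14 = ((26 , 0) , (0 , 0)) , ((0 , 6) , (4 , 0))
  position 15 = ((11 , 0) , (0 , 1)) , ((0 , 1) , (1 , 0))
  position 16 = ((18 , 0) , (0 , 0)) , ((0 , 6) , (0 , 0))
  position 17 = ((6 , 0) , (0 , 0)) , ((0 , 6) , (0 , 0))
  position 18 = ((32 , 0) , (0 , 0)) , ((0 , 0) , (4 , 0))
  position 19 = ((29 , 0) , (0 , 1)) , ((0 , -5) , (1 , 0))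
  position 20 = ((34 , 0) , (0 , 0)) , ((0 , 0) , (2 , 0))
  position _  = ((0 , 0) , (0 , 0)) , ((0 , 0) , (0 , 0))

  -- 144 times the squared length: 144 t² = 216 + 24√33.
  scaledSqLength : Length → Coordinate
  scaledSqLength unit = (144 , 0) , (0 , 0)
  scaledSqLength long = (216 , 0) , (0 , 24)

open Positions public

HasLength : ℕ → ℕ → Length → Set
HasLength i j ℓ = Plane.sqDist ℤ[√3,√11] (position i) (position j) ≡ scaledSqLength ℓ

gadget-lengths : EdgesSatisfy HasLength 0 gadgetEdges
gadget-lengths = from-yes (edgesSatisfy? (λ i j ℓ → Plane.sqDist ℤ[√3,√11] (position i) (position j) ≟ᶜ scaledSqLength ℓ) 0 gadgetEdges)

-- The real plane

module Real (ℝ-model : RealNumbers) where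
  open RealNumbers ℝ-model

  commutativeRing : CommutativeRing 0ℓ 0ℓ
  commutativeRing = record { isCommutativeRing = isCommutativeRing }

  open CommutativeRing commutativeRing
    using ( +-assoc; +-comm; +-identityˡ; +-identityʳ; -‿inverseˡ; -‿inverseʳ
          ; *-assoc; *-identityˡ; *-identityʳ; zeroˡ; semiring; ring; +-abelianGroup; +-commutativeSemigroup )
  -- The optimised n · x has 1 · 1ℝ = 1ℝ definitionally, so the numerals of the ring
  -- solver below agree with 1ℝ on the nose.
  open import Algebra.Properties.Semiring.Mult.TCOptimised semiring
    using (×-homo-+; ×1-homo-*; 1+×) renaming (_×_ to _·_)
  open import Algebra.Properties.Ring ring using (-‿distribˡ-*; -‿distribʳ-*)
  open import Algebra.Properties.AbelianGroup +-abelianGroup using (⁻¹-∙-comm; ⁻¹-involutive; ε⁻¹≈ε)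
  open import Algebra.Properties.CommutativeSemigroup +-commutativeSemigroup using (x∙yz≈y∙xz)
  open ≡-Reasoning

  +-moveʳ : ∀ {x y z} → x + y ≡ z → x ≡ z - y
  +-moveʳ {x} {y} {z} x+y≡z = begin
    x              ≡⟨ +-identityʳ x ⟨
    x + 0ℝ         ≡⟨ cong (x +_) (-‿inverseʳ y) ⟨
    x + (y - y)    ≡⟨ +-assoc x y (- y) ⟨
    (x + y) - y    ≡⟨ cong (_- y) x+y≡z ⟩
    z - y          ∎

  fromℤ : ℤ → ℝ
  fromℤ (ℤ.+ n) = n · 1ℝ
  fromℤ -[1+ n ] = - (suc n · 1ℝ)

  fromℤ-⊖-+ : ∀ m n → fromℤ (m ⊖ n) + n · 1ℝ ≡ m · 1ℝ
  fromℤ-⊖-+ zero zero = +-identityˡ 0ℝ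
  fromℤ-⊖-+ zero (suc n) = -‿inverseˡ (suc n · 1ℝ)
  fromℤ-⊖-+ (suc m) zero = +-identityʳ (suc m · 1ℝ)
  fromℤ-⊖-+ (suc m) (suc n) = begin
    fromℤ (suc m ⊖ suc n) + suc n · 1ℝ  ≡⟨ cong₂ _+_ (cong fromℤ (ℤ.[1+m]⊖[1+n]≡m⊖n m n)) (1+× n 1ℝ) ⟩
    fromℤ (m ⊖ n) + (1ℝ + n · 1ℝ)       ≡⟨ x∙yz≈y∙xz (fromℤ (m ⊖ n)) 1ℝ (n · 1ℝ) ⟩
    1ℝ + (fromℤ (m ⊖ n) + n · 1ℝ)       ≡⟨ cong (1ℝ +_) (fromℤ-⊖-+ m n) ⟩
    1ℝ + m · 1ℝ                         ≡⟨ 1+× m 1ℝ ⟨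
    suc m · 1ℝ                          ∎

  fromℤ-+ : ∀ i j → fromℤ (i ℤ.+ j) ≡ fromℤ i + fromℤ j
  fromℤ-+ (ℤ.+ m) (ℤ.+ n) = ×-homo-+ 1ℝ m n
  fromℤ-+ (ℤ.+ m) -[1+ n ] = +-moveʳ (fromℤ-⊖-+ m (suc n))
  fromℤ-+ -[1+ m ] (ℤ.+ n) = trans (+-moveʳ (fromℤ-⊖-+ n (suc m))) (+-comm (n · 1ℝ) _)
  fromℤ-+ -[1+ m ] -[1+ n ] = begin
    - (suc (suc (m ℕ.+ n)) · 1ℝ)       ≡⟨ cong (λ k → - (suc k · 1ℝ)) (ℕ.+-suc m n) ⟨
    - ((suc m ℕ.+ suc n) · 1ℝ)         ≡⟨ cong -_ (×-homo-+ 1ℝ (suc m) (suc n)) ⟩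
    - (suc m · 1ℝ + suc n · 1ℝ)        ≡⟨ ⁻¹-∙-comm (suc m · 1ℝ) (suc n · 1ℝ) ⟨
    - (suc m · 1ℝ) + - (suc n · 1ℝ)    ∎

  fromℤ-neg : ∀ i → fromℤ (ℤ.- i) ≡ - fromℤ i
  fromℤ-neg (ℤ.+ zero) = sym ε⁻¹≈ε
  fromℤ-neg (ℤ.+ suc n) = refl
  fromℤ-neg -[1+ n ] = sym (⁻¹-involutive (suc n · 1ℝ))

  fromℤ-*-+ : ∀ m j → fromℤ (ℤ.+ m ℤ.* j) ≡ m · 1ℝ * fromℤ j
  fromℤ-*-+ m (ℤ.+ n) = trans (cong fromℤ (sym (ℤ.pos-* m n))) (×1-homo-* m n)
  fromℤ-*-+ m -[1+ n ] = begin
    fromℤ (ℤ.+ m ℤ.* -[1+ n ])         ≡⟨ cong fromℤ (ℤ.neg-distribʳ-* (ℤ.+ m) (ℤ.+ suc n)) ⟨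
    fromℤ (ℤ.- (ℤ.+ m ℤ.* ℤ.+ suc n))  ≡⟨ fromℤ-neg (ℤ.+ m ℤ.* ℤ.+ suc n) ⟩
    - fromℤ (ℤ.+ m ℤ.* ℤ.+ suc n)      ≡⟨ cong -_ (fromℤ-*-+ m (ℤ.+ suc n)) ⟩
    - (m · 1ℝ * suc n · 1ℝ)            ≡⟨ -‿distribʳ-* (m · 1ℝ) (suc n · 1ℝ) ⟩
    m · 1ℝ * - (suc n · 1ℝ)            ∎

  fromℤ-* : ∀ i j → fromℤ (i ℤ.* j) ≡ fromℤ i * fromℤ j
  fromℤ-* (ℤ.+ m) j = fromℤ-*-+ m j
  fromℤ-* -[1+ m ] j = begin
    fromℤ (-[1+ m ] ℤ.* j)             ≡⟨ cong fromℤ (ℤ.neg-distribˡ-* (ℤ.+ suc m) j) ⟨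
    fromℤ (ℤ.- (ℤ.+ suc m ℤ.* j))      ≡⟨ fromℤ-neg (ℤ.+ suc m ℤ.* j) ⟩
    - fromℤ (ℤ.+ suc m ℤ.* j)          ≡⟨ cong -_ (fromℤ-*-+ (suc m) j) ⟩
    - (suc m · 1ℝ * fromℤ j)           ≡⟨ -‿distribˡ-* (suc m · 1ℝ) (fromℤ j) ⟩
    - (suc m · 1ℝ) * fromℤ j           ∎

  fromℕ≡n·1 : ∀ n → fromℕ n ≡ n · 1ℝ
  fromℕ≡n·1 zero = refl
  fromℕ≡n·1 (suc n) = trans (cong (1ℝ +_) (fromℕ≡n·1 n)) (sym (1+× n 1ℝ))

  ℝ-ring : AlmostCommutativeRing 0ℓ 0ℓ
  ℝ-ring = fromCommutativeRing commutativeRing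

  Interpretation : RawRing 0ℓ 0ℓ → Set
  Interpretation K = K -Raw-AlmostCommutative⟶ ℝ-ring

  ℤ-interpretation : Interpretation ℤ.+-*-rawRing
  ℤ-interpretation = record
    { ⟦_⟧ = fromℤ ; +-homo = fromℤ-+ ; *-homo = fromℤ-* ; -‿homo = fromℤ-neg
    ; 0-homo = refl ; 1-homo = refl }

  module Solver = Algebra.Solver.Ring ℤ.+-*-rawRing ℝ-ring ℤ-interpretation
    (λ i j → Maybe.map (cong fromℤ) (dec⇒maybe (i ℤ.≟ j)))
  open Solver using (solve; _:=_; con; _:+_; _:*_; :-_; _:-_)

  κ : ∀ {m} → ℕ → Solver.Polynomial m
  κ n = con (ℤ.+ n)

  x≤y⇒0≤y-x : ∀ {x y} → x ≤ y → 0ℝ ≤ y - x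
  x≤y⇒0≤y-x {x} {y} x≤y = subst (_≤ y - x) (-‿inverseʳ x) (+-mono-≤ (- x) x≤y)

  0≤y-x⇒x≤y : ∀ {x y} → 0ℝ ≤ y - x → x ≤ y
  0≤y-x⇒x≤y {x} {y} 0≤y-x = subst₂ _≤_ (+-identityˡ x) (solve 2 (λ x y → y :- x :+ x := y) refl x y) (+-mono-≤ x 0≤y-x)

  x-y≡0⇒x≡y : ∀ {x y} → x - y ≡ 0ℝ → x ≡ y
  x-y≡0⇒x≡y {x} {y} x-y≡0 = begin
    x          ≡⟨ solve 2 (λ x y → x := x :- y :+ y) refl x y ⟩
    x - y + y  ≡⟨ cong (_+ y) x-y≡0 ⟩
    0ℝ + y     ≡⟨ +-identityˡ y ⟩
    y          ∎

  x≤0⇒0≤-x : ∀ {x} → x ≤ 0ℝ → 0ℝ ≤ - x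
  x≤0⇒0≤-x {x} x≤0 = subst (0ℝ ≤_) (+-identityˡ (- x)) (x≤y⇒0≤y-x x≤0)

  0≤x⇒-x≤0 : ∀ {x} → 0ℝ ≤ x → - x ≤ 0ℝ
  0≤x⇒-x≤0 {x} 0≤x = subst₂ _≤_ (+-identityˡ (- x)) (-‿inverseʳ x) (+-mono-≤ (- x) 0≤x)

  x≤x+y : ∀ {x y} → 0ℝ ≤ y → x ≤ x + y
  x≤x+y {x} {y} 0≤y = subst₂ _≤_ (+-identityˡ x) (+-comm y x) (+-mono-≤ x 0≤y)

  +-nonneg : ∀ {x y} → 0ℝ ≤ x → 0ℝ ≤ y → 0ℝ ≤ x + y
  +-nonneg 0≤x 0≤y = ≤-trans 0≤x (x≤x+y 0≤y)

  0≤x*x : ∀ x → 0ℝ ≤ x * x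
  0≤x*x x with ≤-total 0ℝ x
  ... | inj₁ 0≤x = *-nonneg 0≤x 0≤x
  ... | inj₂ x≤0 = subst (0ℝ ≤_) (solve 1 (λ x → (:- x) :* (:- x) := x :* x) refl x)
                         (*-nonneg (x≤0⇒0≤-x x≤0) (x≤0⇒0≤-x x≤0))

  0≤1 : 0ℝ ≤ 1ℝ
  0≤1 = subst (0ℝ ≤_) (*-identityˡ 1ℝ) (0≤x*x 1ℝ)

  1≤x⇒x≢0 : ∀ {x} → 1ℝ ≤ x → x ≢ 0ℝ
  1≤x⇒x≢0 1≤x refl = 0≢1 (≤-antisym 0≤1 1≤x)

  0≤n·1 : ∀ n → 0ℝ ≤ n · 1ℝ
  0≤n·1 zero = ≤-refl 0ℝ
  0≤n·1 (suc n) = subst (0ℝ ≤_) (sym (1+× n 1ℝ)) (+-nonneg 0≤1 (0≤n·1 n))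

  n·1≢0 : ∀ n .{{_ : ℕ.NonZero n}} → n · 1ℝ ≢ 0ℝ
  n·1≢0 (suc n) = 1≤x⇒x≢0 (subst (1ℝ ≤_) (sym (1+× n 1ℝ)) (x≤x+y (0≤n·1 n)))

  inverse-nonneg : ∀ {x y} → 0ℝ ≤ x → x * y ≡ 1ℝ → 0ℝ ≤ y
  inverse-nonneg {x} {y} 0≤x x*y≡1 = subst (0ℝ ≤_) x*[y*y]≡y (*-nonneg 0≤x (0≤x*x y))
    where
    x*[y*y]≡y : x * (y * y) ≡ y
    x*[y*y]≡y = trans (sym (*-assoc x y y)) (trans (cong (_* y) x*y≡1) (*-identityˡ y))

  *-cancelʳ : ∀ {x p p⁻¹} → p * p⁻¹ ≡ 1ℝ → x * p * p⁻¹ ≡ x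
  *-cancelʳ {x} {p} {p⁻¹} p*p⁻¹≡1 = begin
    x * p * p⁻¹      ≡⟨ *-assoc x p p⁻¹ ⟩
    x * (p * p⁻¹)    ≡⟨ cong (x *_) p*p⁻¹≡1 ⟩
    x * 1ℝ           ≡⟨ *-identityʳ x ⟩
    x                ∎

  *-cancelʳ-nonneg : ∀ {x y p p⁻¹} → 0ℝ ≤ p → p * p⁻¹ ≡ 1ℝ → x * p ≡ y → 0ℝ ≤ y → 0ℝ ≤ x
  *-cancelʳ-nonneg {x} {y} {p} {p⁻¹} 0≤p p*p⁻¹≡1 x*p≡y 0≤y =
    subst (0ℝ ≤_) (trans (cong (_* p⁻¹) (sym x*p≡y)) (*-cancelʳ p*p⁻¹≡1))
          (*-nonneg 0≤y (inverse-nonneg 0≤p p*p⁻¹≡1))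

  *-cancelʳ-zero : ∀ {x p p⁻¹} → p * p⁻¹ ≡ 1ℝ → x * p ≡ 0ℝ → x ≡ 0ℝ
  *-cancelʳ-zero {x} {p} {p⁻¹} p*p⁻¹≡1 x*p≡0 =
    trans (sym (*-cancelʳ p*p⁻¹≡1)) (trans (cong (_* p⁻¹) x*p≡0) (zeroˡ p⁻¹))

  ≤-square-antisym : ∀ {x y} → 0ℝ ≤ x → x ≤ y → y * y ≤ x * x → x + y ≢ 0ℝ → x ≡ y
  ≤-square-antisym {x} {y} 0≤x x≤y y*y≤x*x x+y≢0 =
    sym (x-y≡0⇒x≡y (*-cancelʳ-zero (proj₂ (inverse (x + y) x+y≢0)) [y-x]*[x+y]≡0))
    where
    [y-x]*[x+y]≡0 : (y - x) * (x + y) ≡ 0ℝ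
    [y-x]*[x+y]≡0 = ≤-antisym
      (subst (_≤ 0ℝ) (solve 2 (λ x y → :- (x :* x :- y :* y) := (y :- x) :* (x :+ y)) refl x y)
             (0≤x⇒-x≤0 (x≤y⇒0≤y-x y*y≤x*x)))
      (*-nonneg (x≤y⇒0≤y-x x≤y) (+-nonneg 0≤x (≤-trans 0≤x x≤y)))

  module SquareRoot (a : ℝ) (0≤a : 0ℝ ≤ a) (a≢0 : a ≢ 0ℝ) where

    IsUpper : ℝ → Set
    IsUpper w = 0ℝ ≤ w × a ≤ w * w

    IsLower : ℝ → Set
    IsLower y = ∀ w → IsUpper w → y ≤ w

    k : ℝ
    k = 1ℝ + a

    k-upper : IsUpper k
    k-upper = +-nonneg 0≤1 0≤a , 0≤y-x⇒x≤y (subst (0ℝ ≤_) 1+a+a*a≡k*k-a (+-nonneg 0≤1 (+-nonneg 0≤a (0≤x*x a))))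
      where
      1+a+a*a≡k*k-a : 1ℝ + (a + a * a) ≡ k * k - a
      1+a+a*a≡k*k-a = solve 1 (λ a → κ 1 :+ (a :+ a :* a) := (κ 1 :+ a) :* (κ 1 :+ a) :- a) refl a

    supremum : ∃ λ r → (∀ y → IsLower y → y ≤ r) × (∀ b → (∀ y → IsLower y → y ≤ b) → r ≤ b)
    supremum = completeness IsLower (0ℝ , λ w → proj₁) (k , λ y y-lower → y-lower k k-upper)

    r : ℝ
    r = proj₁ supremum

    r-greatest : ∀ y → IsLower y → y ≤ r
    r-greatest = proj₁ (proj₂ supremum)

    r-lower : IsLower r
    r-lower w w-upper = proj₂ (proj₂ supremum) w (λ y y-lower → y-lower w w-upper)

    0≤r : 0ℝ ≤ r
    0≤r = r-greatest 0ℝ (λ w → proj₁)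

    -- One step of the iteration x ↦ (k x + a) / (x + k) towards √a. It never overshoots:
    -- (q − r)(r + k) = a − r² and (q² − a)(r + k)² = (k² − a)(r² − a) with k² > a.
    p : ℝ
    p = r + k

    0≤p : 0ℝ ≤ p
    0≤p = +-nonneg 0≤r (proj₁ k-upper)

    p-invertible : ∃ λ p⁻¹ → p * p⁻¹ ≡ 1ℝ
    p-invertible = inverse p (1≤x⇒x≢0 (subst (1ℝ ≤_) 1+[r+a]≡p (x≤x+y (+-nonneg 0≤r 0≤a))))
      where
      1+[r+a]≡p : 1ℝ + (r + a) ≡ p
      1+[r+a]≡p = solve 3 (λ r a u → u :+ (r :+ a) := r :+ (u :+ a)) refl r a 1ℝ

    p⁻¹ : ℝ
    p⁻¹ = proj₁ p-invertible

    p*p⁻¹≡1 : p * p⁻¹ ≡ 1ℝ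
    p*p⁻¹≡1 = proj₂ p-invertible

    p²*p⁻¹²≡1 : (p * p) * (p⁻¹ * p⁻¹) ≡ 1ℝ
    p²*p⁻¹²≡1 = begin
      (p * p) * (p⁻¹ * p⁻¹)  ≡⟨ solve 2 (λ p i → (p :* p) :* (i :* i) := (p :* i) :* (p :* i)) refl p p⁻¹ ⟩
      (p * p⁻¹) * (p * p⁻¹)  ≡⟨ cong (λ x → x * x) p*p⁻¹≡1 ⟩
      1ℝ * 1ℝ                ≡⟨ *-identityˡ 1ℝ ⟩
      1ℝ                     ∎

    q : ℝ
    q = (k * r + a) * p⁻¹

    q*p≡k*r+a : q * p ≡ k * r + a
    q*p≡k*r+a = begin
      (k * r + a) * p⁻¹ * p    ≡⟨ solve 3 (λ x y z → x :* y :* z := x :* z :* y) refl (k * r + a) p⁻¹ p ⟩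
      (k * r + a) * p * p⁻¹    ≡⟨ *-cancelʳ p*p⁻¹≡1 ⟩
      k * r + a                ∎

    [q-r]*p≡a-r*r : (q - r) * p ≡ a - r * r
    [q-r]*p≡a-r*r = begin
      (q - r) * p               ≡⟨ solve 3 (λ q r p → (q :- r) :* p := q :* p :- r :* p) refl q r p ⟩
      q * p - r * p             ≡⟨ cong (_- r * p) q*p≡k*r+a ⟩
      k * r + a - r * (r + k)   ≡⟨ solve 3 (λ k r a → k :* r :+ a :- r :* (r :+ k) := a :- r :* r) refl k r a ⟩
      a - r * r                 ∎

    [r-q]*p≡r*r-a : (r - q) * p ≡ r * r - a
    [r-q]*p≡r*r-a = begin
      (r - q) * p               ≡⟨ solve 3 (λ q r p → (r :- q) :* p := r :* p :- q :* p) refl q r p ⟩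
      r * p - q * p             ≡⟨ cong (λ x → r * p - x) q*p≡k*r+a ⟩
      r * (r + k) - (k * r + a) ≡⟨ solve 3 (λ k r a → r :* (r :+ k) :- (k :* r :+ a) := r :* r :- a) refl k r a ⟩
      r * r - a                 ∎

    [q*q-a]*p²≡[k*k-a]*[r*r-a] : (q * q - a) * (p * p) ≡ (k * k - a) * (r * r - a)
    [q*q-a]*p²≡[k*k-a]*[r*r-a] = begin
      (q * q - a) * (p * p)
        ≡⟨ solve 3 (λ q a p → (q :* q :- a) :* (p :* p) := (q :* p) :* (q :* p) :- a :* (p :* p)) refl q a p ⟩
      (q * p) * (q * p) - a * (p * p)
        ≡⟨ cong (λ x → x * x - a * (p * p)) q*p≡k*r+a ⟩
      (k * r + a) * (k * r + a) - a * ((r + k) * (r + k))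
        ≡⟨ solve 3 (λ k r a → (k :* r :+ a) :* (k :* r :+ a) :- a :* ((r :+ k) :* (r :+ k))
                           := (k :* k :- a) :* (r :* r :- a)) refl k r a ⟩
      (k * k - a) * (r * r - a) ∎

    [a-q*q]*p²≡[k*k-a]*[a-r*r] : (a - q * q) * (p * p) ≡ (k * k - a) * (a - r * r)
    [a-q*q]*p²≡[k*k-a]*[a-r*r] = begin
      (a - q * q) * (p * p)
        ≡⟨ solve 3 (λ q a p → (a :- q :* q) :* (p :* p) := a :* (p :* p) :- (q :* p) :* (q :* p)) refl q a p ⟩
      a * (p * p) - (q * p) * (q * p)
        ≡⟨ cong (λ x → a * (p * p) - x * x) q*p≡k*r+a ⟩
      a * ((r + k) * (r + k)) - (k * r + a) * (k * r + a)
        ≡⟨ solve 3 (λ k r a → a :* ((r :+ k) :* (r :+ k)) :- (k :* r :+ a) :* (k :* r :+ a)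
                           := (k :* k :- a) :* (a :- r :* r)) refl k r a ⟩
      (k * k - a) * (a - r * r) ∎

    0≤k*k-a : 0ℝ ≤ k * k - a
    0≤k*k-a = x≤y⇒0≤y-x (proj₂ k-upper)

    q≡r⇒r*r≡a : q ≡ r → r * r ≡ a
    q≡r⇒r*r≡a q≡r = sym (x-y≡0⇒x≡y (begin
      a - r * r    ≡⟨ [q-r]*p≡a-r*r ⟨
      (q - r) * p  ≡⟨ cong (λ x → (x - r) * p) q≡r ⟩
      (r - r) * p  ≡⟨ cong (_* p) (-‿inverseʳ r) ⟩
      0ℝ * p       ≡⟨ zeroˡ p ⟩
      0ℝ           ∎))

    a≤r*r⇒r*r≡a : a ≤ r * r → r * r ≡ a
    a≤r*r⇒r*r≡a a≤r*r = q≡r⇒r*r≡a (≤-antisym q≤r (r-lower q q-upper))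
      where
      q≤r : q ≤ r
      q≤r = 0≤y-x⇒x≤y (*-cancelʳ-nonneg 0≤p p*p⁻¹≡1 [r-q]*p≡r*r-a (x≤y⇒0≤y-x a≤r*r))
      q-upper : IsUpper q
      q-upper = *-nonneg (+-nonneg (*-nonneg (proj₁ k-upper) 0≤r) 0≤a) (inverse-nonneg 0≤p p*p⁻¹≡1)
              , 0≤y-x⇒x≤y (*-cancelʳ-nonneg (0≤x*x p) p²*p⁻¹²≡1 [q*q-a]*p²≡[k*k-a]*[r*r-a]
                                            (*-nonneg 0≤k*k-a (x≤y⇒0≤y-x a≤r*r)))

    r*r≤a⇒r*r≡a : r * r ≤ a → r * r ≡ a
    r*r≤a⇒r*r≡a r*r≤a = q≡r⇒r*r≡a (≤-antisym (r-greatest q q-lower) r≤q)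
      where
      r≤q : r ≤ q
      r≤q = 0≤y-x⇒x≤y (*-cancelʳ-nonneg 0≤p p*p⁻¹≡1 [q-r]*p≡a-r*r (x≤y⇒0≤y-x r*r≤a))
      q*q≤a : q * q ≤ a
      q*q≤a = 0≤y-x⇒x≤y (*-cancelʳ-nonneg (0≤x*x p) p²*p⁻¹²≡1 [a-q*q]*p²≡[k*k-a]*[a-r*r]
                                          (*-nonneg 0≤k*k-a (x≤y⇒0≤y-x r*r≤a)))
      q-lower : IsLower q
      q-lower w (0≤w , a≤w*w) = [ (λ q≤w → q≤w) , (λ w≤q → subst (q ≤_) (sym (w≡q w≤q)) (≤-refl q)) ]′ (≤-total q w)
        where
        w+q≢0 : w + q ≢ 0ℝ
        w+q≢0 w+q≡0 = a≢0 (≤-antisym (subst (a ≤_) w*w≡0 a≤w*w) 0≤a)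
          where
          w*w≡0 : w * w ≡ 0ℝ
          w*w≡0 = trans (cong (_* w) w≡0) (zeroˡ w)
            where
            w≡0 : w ≡ 0ℝ
            w≡0 = ≤-antisym (subst (w ≤_) w+q≡0 (x≤x+y (≤-trans 0≤r r≤q))) 0≤w
        w≡q : w ≤ q → w ≡ q
        w≡q w≤q = ≤-square-antisym 0≤w w≤q (≤-trans q*q≤a a≤w*w) w+q≢0

    root : ∃ λ x → 0ℝ ≤ x × x * x ≡ a
    root = r , 0≤r , [ r*r≤a⇒r*r≡a , a≤r*r⇒r*r≡a ]′ (≤-total (r * r) a)

  sqrt : ∀ a → 0ℝ ≤ a → a ≢ 0ℝ → ∃ λ x → 0ℝ ≤ x × x * x ≡ a
  sqrt = SquareRoot.root

  module _ {K : RawRing 0ℓ 0ℓ} (ι : Interpretation K) where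
    open RawRing K using () renaming (Carrier to C; _+_ to _⊕_; _*_ to _⊗_; -_ to ⊝_; 0# to 0ᶜ; 1# to 1ᶜ)
    open _-Raw-AlmostCommutative⟶_ ι

    adjoinRoot-interpretation : (d : C) (ρ : ℝ) → ρ * ρ ≡ ⟦ d ⟧ → Interpretation (adjoinRoot K d)
    adjoinRoot-interpretation d ρ ρ*ρ≡d = record
      { ⟦_⟧ = λ (a , b) → ⟦ a ⟧ + ⟦ b ⟧ * ρ
      ; +-homo = λ (a , b) (a′ , b′) → begin
          ⟦ a ⊕ a′ ⟧ + ⟦ b ⊕ b′ ⟧ * ρ
            ≡⟨ cong₂ (λ x y → x + y * ρ) (+-homo a a′) (+-homo b b′) ⟩
          (⟦ a ⟧ + ⟦ a′ ⟧) + (⟦ b ⟧ + ⟦ b′ ⟧) * ρ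
            ≡⟨ solve 5 (λ x x′ y y′ ρ → (x :+ x′) :+ (y :+ y′) :* ρ := (x :+ y :* ρ) :+ (x′ :+ y′ :* ρ)) refl ⟦ a ⟧ ⟦ a′ ⟧ ⟦ b ⟧ ⟦ b′ ⟧ ρ ⟩
          (⟦ a ⟧ + ⟦ b ⟧ * ρ) + (⟦ a′ ⟧ + ⟦ b′ ⟧ * ρ) ∎
      ; *-homo = λ (a , b) (a′ , b′) → begin
          ⟦ a ⊗ a′ ⊕ d ⊗ (b ⊗ b′) ⟧ + ⟦ a ⊗ b′ ⊕ b ⊗ a′ ⟧ * ρ
            ≡⟨ cong₂ (λ x y → x + y * ρ) (trans (+-homo _ _) (cong₂ _+_ (*-homo a a′) (trans (*-homo d _) (cong (⟦ d ⟧ *_) (*-homo b b′)))))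
                                         (trans (+-homo _ _) (cong₂ _+_ (*-homo a b′) (*-homo b a′))) ⟩
          (⟦ a ⟧ * ⟦ a′ ⟧ + ⟦ d ⟧ * (⟦ b ⟧ * ⟦ b′ ⟧)) + (⟦ a ⟧ * ⟦ b′ ⟧ + ⟦ b ⟧ * ⟦ a′ ⟧) * ρ
            ≡⟨ cong (λ δ → (⟦ a ⟧ * ⟦ a′ ⟧ + δ * (⟦ b ⟧ * ⟦ b′ ⟧)) + (⟦ a ⟧ * ⟦ b′ ⟧ + ⟦ b ⟧ * ⟦ a′ ⟧) * ρ) ρ*ρ≡d ⟨
          (⟦ a ⟧ * ⟦ a′ ⟧ + ρ * ρ * (⟦ b ⟧ * ⟦ b′ ⟧)) + (⟦ a ⟧ * ⟦ b′ ⟧ + ⟦ b ⟧ * ⟦ a′ ⟧) * ρ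
            ≡⟨ solve 5 (λ x x′ y y′ ρ → (x :* x′ :+ ρ :* ρ :* (y :* y′)) :+ (x :* y′ :+ y :* x′) :* ρ := (x :+ y :* ρ) :* (x′ :+ y′ :* ρ)) refl ⟦ a ⟧ ⟦ a′ ⟧ ⟦ b ⟧ ⟦ b′ ⟧ ρ ⟩
          (⟦ a ⟧ + ⟦ b ⟧ * ρ) * (⟦ a′ ⟧ + ⟦ b′ ⟧ * ρ) ∎
      ; -‿homo = λ (a , b) → begin
          ⟦ ⊝ a ⟧ + ⟦ ⊝ b ⟧ * ρ     ≡⟨ cong₂ (λ x y → x + y * ρ) (-‿homo a) (-‿homo b) ⟩
          - ⟦ a ⟧ + - ⟦ b ⟧ * ρ     ≡⟨ solve 3 (λ x y ρ → :- x :+ :- y :* ρ := :- (x :+ y :* ρ)) refl ⟦ a ⟧ ⟦ b ⟧ ρ ⟩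
          - (⟦ a ⟧ + ⟦ b ⟧ * ρ)     ∎
      ; 0-homo = begin
          ⟦ 0ᶜ ⟧ + ⟦ 0ᶜ ⟧ * ρ       ≡⟨ cong₂ (λ x y → x + y * ρ) 0-homo 0-homo ⟩
          0ℝ + 0ℝ * ρ               ≡⟨ solve 1 (λ ρ → κ 0 :+ κ 0 :* ρ := κ 0) refl ρ ⟩
          0ℝ                        ∎
      ; 1-homo = begin
          ⟦ 1ᶜ ⟧ + ⟦ 0ᶜ ⟧ * ρ       ≡⟨ cong₂ (λ x y → x + y * ρ) 1-homo 0-homo ⟩
          1ℝ + 0ℝ * ρ               ≡⟨ solve 1 (λ ρ → κ 1 :+ κ 0 :* ρ := κ 1) refl ρ ⟩
          1ℝ                        ∎
      }

  sqDist : E² → E² → ℝ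
  sqDist (x₁ , x₂) (y₁ , y₂) = (x₁ - y₁) * (x₁ - y₁) + (x₂ - y₂) * (x₂ - y₂)

  IsIsometry : (E² → E²) → Set
  IsIsometry M = ∀ x y → sqDist (M x) (M y) ≡ sqDist x y

  segment-congruence : ∀ {m m⁻¹} o u p q → sqDist u o ≡ m → sqDist q p ≡ m → m * m⁻¹ ≡ 1ℝ →
                       Σ (E² → E²) λ M → IsIsometry M × M o ≡ p × M u ≡ q
  segment-congruence {m} {m⁻¹} (o₁ , o₂) (u₁ , u₂) (p₁ , p₂) (q₁ , q₂) |u-o|²≡m |q-p|²≡m m*m⁻¹≡1 =
    M , isometry , M-o≡p , M-u≡q
    where
    x₁ x₂ y₁ y₂ cos sin : ℝ
    x₁ = u₁ - o₁
    x₂ = u₂ - o₂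
    y₁ = q₁ - p₁
    y₂ = q₂ - p₂
    cos = (x₁ * y₁ + x₂ * y₂) * m⁻¹
    sin = (x₁ * y₂ - x₂ * y₁) * m⁻¹

    M : E² → E²
    M (z₁ , z₂) = p₁ + (cos * (z₁ - o₁) - sin * (z₂ - o₂)) , p₂ + (sin * (z₁ - o₁) + cos * (z₂ - o₂))

    cos²+sin²≡1 : cos * cos + sin * sin ≡ 1ℝ
    cos²+sin²≡1 = begin
      cos * cos + sin * sin
        ≡⟨ solve 5 (λ x₁ x₂ y₁ y₂ i → ((x₁ :* y₁ :+ x₂ :* y₂) :* i) :* ((x₁ :* y₁ :+ x₂ :* y₂) :* i) :+ ((x₁ :* y₂ :- x₂ :* y₁) :* i) :* ((x₁ :* y₂ :- x₂ :* y₁) :* i)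
                    := ((x₁ :* x₁ :+ x₂ :* x₂) :* i) :* ((y₁ :* y₁ :+ y₂ :* y₂) :* i)) refl x₁ x₂ y₁ y₂ m⁻¹ ⟩
      (sqDist (u₁ , u₂) (o₁ , o₂) * m⁻¹) * (sqDist (q₁ , q₂) (p₁ , p₂) * m⁻¹)
        ≡⟨ cong₂ (λ a b → (a * m⁻¹) * (b * m⁻¹)) |u-o|²≡m |q-p|²≡m ⟩
      (m * m⁻¹) * (m * m⁻¹)  ≡⟨ cong (λ a → a * a) m*m⁻¹≡1 ⟩
      1ℝ * 1ℝ                ≡⟨ *-identityˡ 1ℝ ⟩
      1ℝ                     ∎

    isometry : IsIsometry M
    isometry (z₁ , z₂) (w₁ , w₂) = begin
      sqDist (M (z₁ , z₂)) (M (w₁ , w₂))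
        ≡⟨ solve 10 (λ c s p₁ p₂ o₁ o₂ z₁ z₂ w₁ w₂ →
               (p₁ :+ (c :* (z₁ :- o₁) :- s :* (z₂ :- o₂)) :- (p₁ :+ (c :* (w₁ :- o₁) :- s :* (w₂ :- o₂))))
            :* (p₁ :+ (c :* (z₁ :- o₁) :- s :* (z₂ :- o₂)) :- (p₁ :+ (c :* (w₁ :- o₁) :- s :* (w₂ :- o₂))))
            :+ (p₂ :+ (s :* (z₁ :- o₁) :+ c :* (z₂ :- o₂)) :- (p₂ :+ (s :* (w₁ :- o₁) :+ c :* (w₂ :- o₂))))
            :* (p₂ :+ (s :* (z₁ :- o₁) :+ c :* (z₂ :- o₂)) :- (p₂ :+ (s :* (w₁ :- o₁) :+ c :* (w₂ :- o₂))))
            := (c :* c :+ s :* s) :* ((z₁ :- w₁) :* (z₁ :- w₁) :+ (z₂ :- w₂) :* (z₂ :- w₂)))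
            refl cos sin p₁ p₂ o₁ o₂ z₁ z₂ w₁ w₂ ⟩
      (cos * cos + sin * sin) * sqDist (z₁ , z₂) (w₁ , w₂) ≡⟨ cong (_* sqDist (z₁ , z₂) (w₁ , w₂)) cos²+sin²≡1 ⟩
      1ℝ * sqDist (z₁ , z₂) (w₁ , w₂)                      ≡⟨ *-identityˡ _ ⟩
      sqDist (z₁ , z₂) (w₁ , w₂)                           ∎

    M-o≡p : M (o₁ , o₂) ≡ (p₁ , p₂)
    M-o≡p = cong₂ _,_
      (solve 5 (λ c s p₁ o₁ o₂ → p₁ :+ (c :* (o₁ :- o₁) :- s :* (o₂ :- o₂)) := p₁) refl cos sin p₁ o₁ o₂)
      (solve 5 (λ c s p₂ o₁ o₂ → p₂ :+ (s :* (o₁ :- o₁) :+ c :* (o₂ :- o₂)) := p₂) refl cos sin p₂ o₁ o₂)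

    p+[q-p]≡q : ∀ {pᵢ qᵢ} → pᵢ + (qᵢ - pᵢ) * (sqDist (u₁ , u₂) (o₁ , o₂) * m⁻¹) ≡ qᵢ
    p+[q-p]≡q {pᵢ} {qᵢ} = begin
      pᵢ + (qᵢ - pᵢ) * (sqDist (u₁ , u₂) (o₁ , o₂) * m⁻¹) ≡⟨ cong (λ a → pᵢ + (qᵢ - pᵢ) * (a * m⁻¹)) |u-o|²≡m ⟩
      pᵢ + (qᵢ - pᵢ) * (m * m⁻¹)                           ≡⟨ cong (λ a → pᵢ + (qᵢ - pᵢ) * a) m*m⁻¹≡1 ⟩
      pᵢ + (qᵢ - pᵢ) * 1ℝ                                  ≡⟨ solve 2 (λ p q → p :+ (q :- p) :* κ 1 := q) refl pᵢ qᵢ ⟩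
      qᵢ                                                   ∎

    M-u≡q : M (u₁ , u₂) ≡ (q₁ , q₂)
    M-u≡q = cong₂ _,_
      (trans (solve 6 (λ x₁ x₂ y₁ y₂ i p₁ → p₁ :+ ((x₁ :* y₁ :+ x₂ :* y₂) :* i :* x₁ :- (x₁ :* y₂ :- x₂ :* y₁) :* i :* x₂)
                                             := p₁ :+ y₁ :* ((x₁ :* x₁ :+ x₂ :* x₂) :* i)) refl x₁ x₂ y₁ y₂ m⁻¹ p₁) p+[q-p]≡q)
      (trans (solve 6 (λ x₁ x₂ y₁ y₂ i p₂ → p₂ :+ ((x₁ :* y₂ :- x₂ :* y₁) :* i :* x₁ :+ (x₁ :* y₁ :+ x₂ :* y₂) :* i :* x₂)
                                             := p₂ :+ y₂ :* ((x₁ :* x₁ :+ x₂ :* x₂) :* i)) refl x₁ x₂ y₁ y₂ m⁻¹ p₂) p+[q-p]≡q)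

  module _ {K : RawRing 0ℓ 0ℓ} (ι : Interpretation K) where
    open _-Raw-AlmostCommutative⟶_ ι

    embed : ℝ → RawRing.Carrier K × RawRing.Carrier K → E²
    embed λ′ (x , y) = ⟦ x ⟧ * λ′ , ⟦ y ⟧ * λ′

    sqDist-embed : ∀ λ′ u v → sqDist (embed λ′ u) (embed λ′ v) ≡ ⟦ Plane.sqDist K u v ⟧ * (λ′ * λ′)
    sqDist-embed λ′ (x₁ , x₂) (y₁ , y₂) = sym (begin
      ⟦ (x₁ ⊕ ⊝ y₁) ⊗ (x₁ ⊕ ⊝ y₁) ⊕ (x₂ ⊕ ⊝ y₂) ⊗ (x₂ ⊕ ⊝ y₂) ⟧ * (λ′ * λ′)
        ≡⟨ cong (_* (λ′ * λ′)) (trans (+-homo _ _) (cong₂ _+_ (square x₁ y₁) (square x₂ y₂))) ⟩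
      ((⟦ x₁ ⟧ - ⟦ y₁ ⟧) * (⟦ x₁ ⟧ - ⟦ y₁ ⟧) + (⟦ x₂ ⟧ - ⟦ y₂ ⟧) * (⟦ x₂ ⟧ - ⟦ y₂ ⟧)) * (λ′ * λ′)
        ≡⟨ solve 5 (λ x₁ x₂ y₁ y₂ l → ((x₁ :- y₁) :* (x₁ :- y₁) :+ (x₂ :- y₂) :* (x₂ :- y₂)) :* (l :* l)
                   := (x₁ :* l :- y₁ :* l) :* (x₁ :* l :- y₁ :* l) :+ (x₂ :* l :- y₂ :* l) :* (x₂ :* l :- y₂ :* l))
                   refl ⟦ x₁ ⟧ ⟦ x₂ ⟧ ⟦ y₁ ⟧ ⟦ y₂ ⟧ λ′ ⟩
      sqDist (embed λ′ (x₁ , x₂)) (embed λ′ (y₁ , y₂)) ∎)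
      where
      open RawRing K using () renaming (_+_ to _⊕_; _*_ to _⊗_; -_ to ⊝_)
      square : ∀ x y → ⟦ (x ⊕ ⊝ y) ⊗ (x ⊕ ⊝ y) ⟧ ≡ (⟦ x ⟧ - ⟦ y ⟧) * (⟦ x ⟧ - ⟦ y ⟧)
      square x y = trans (*-homo _ _) (cong (λ a → a * a) (trans (+-homo x (⊝ y)) (cong (⟦ x ⟧ +_) (-‿homo y))))

  module Realisation (s t : ℝ) (s*s≡33 : s * s ≡ fromℕ 33) (0≤t : 0ℝ ≤ t)
                     (6t²≡9+s : fromℕ 6 * (t * t) ≡ fromℕ 9 + s) where

    D : ℝ → Set
    D d = d ≡ 1ℝ ⊎ d ≡ t

    adjacent : ∀ {p q d} → D d → 0ℝ ≤ d → sqDist p q ≡ d * d → Adjacent D p q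
    adjacent D-d 0≤d |p-q|²≡d² = _ , D-d , 0≤d , sym |p-q|²≡d²

    √3-root : ∃ λ x → 0ℝ ≤ x × x * x ≡ 3 · 1ℝ
    √3-root = sqrt (3 · 1ℝ) (0≤n·1 3) (n·1≢0 3)

    ⅓-inverse : ∃ λ x → 3 · 1ℝ * x ≡ 1ℝ
    ⅓-inverse = inverse (3 · 1ℝ) (n·1≢0 3)

    ⅟₁₂-inverse : ∃ λ x → 12 · 1ℝ * x ≡ 1ℝ
    ⅟₁₂-inverse = inverse (12 · 1ℝ) (n·1≢0 12)

    √3 ⅓ √11 ⅟₁₂ : ℝ
    √3 = proj₁ √3-root
    ⅓ = proj₁ ⅓-inverse
    √11 = s * √3 * ⅓
    ⅟₁₂ = proj₁ ⅟₁₂-inverse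

    √3*√3≡3 : √3 * √3 ≡ 3 · 1ℝ
    √3*√3≡3 = proj₂ (proj₂ √3-root)

    √3*√11≡s : √3 * √11 ≡ s
    √3*√11≡s = begin
      √3 * (s * √3 * ⅓)   ≡⟨ solve 3 (λ r s i → r :* (s :* r :* i) := s :* (r :* r) :* i) refl √3 s ⅓ ⟩
      s * (√3 * √3) * ⅓   ≡⟨ cong (λ x → s * x * ⅓) √3*√3≡3 ⟩
      s * 3 · 1ℝ * ⅓      ≡⟨ *-cancelʳ (proj₂ ⅓-inverse) ⟩
      s                   ∎

    √11*√11≡11 : √11 * √11 ≡ 11 · 1ℝ + 0 · 1ℝ * √3
    √11*√11≡11 = begin
      (s * √3 * ⅓) * (s * √3 * ⅓)
        ≡⟨ solve 3 (λ r s i → (s :* r :* i) :* (s :* r :* i) := (s :* s) :* (r :* r) :* (i :* i)) refl √3 s ⅓ ⟩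
      (s * s) * (√3 * √3) * (⅓ * ⅓)
        ≡⟨ cong₂ (λ x y → x * y * (⅓ * ⅓)) (trans s*s≡33 (fromℕ≡n·1 33)) √3*√3≡3 ⟩
      33 · 1ℝ * 3 · 1ℝ * (⅓ * ⅓)
        ≡⟨ solve 2 (λ r i → κ 33 :* κ 3 :* (i :* i) := (κ 11 :+ κ 0 :* r) :* κ 3 :* i :* κ 3 :* i) refl √3 ⅓ ⟩
      (11 · 1ℝ + 0 · 1ℝ * √3) * 3 · 1ℝ * ⅓ * 3 · 1ℝ * ⅓
        ≡⟨ cong (_* ⅓) (cong (_* 3 · 1ℝ) (*-cancelʳ (proj₂ ⅓-inverse))) ⟩
      (11 · 1ℝ + 0 · 1ℝ * √3) * 3 · 1ℝ * ⅓
        ≡⟨ *-cancelʳ (proj₂ ⅓-inverse) ⟩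
      11 · 1ℝ + 0 · 1ℝ * √3 ∎

    ℚ[√3,√11] : Interpretation ℤ[√3,√11]
    ℚ[√3,√11] = adjoinRoot-interpretation (adjoinRoot-interpretation ℤ-interpretation (ℤ.+ 3) √3 √3*√3≡3)
                                          (ℤ.+ 11 , ℤ.+ 0) √11 √11*√11≡11

    open _-Raw-AlmostCommutative⟶_ ℚ[√3,√11] using (⟦_⟧)

    vertex : ℕ → E²
    vertex i = embed ℚ[√3,√11] ⅟₁₂ (position i)

    length : Length → ℝ
    length unit = 1ℝ
    length long = t

    D-length : ∀ ℓ → D (length ℓ)
    D-length unit = inj₁ refl
    D-length long = inj₂ refl

    0≤length : ∀ ℓ → 0ℝ ≤ length ℓ
    0≤length unit = 0≤1
    0≤length long = 0≤t

    *144*⅟₁₂²≡ : ∀ x → x * 144 · 1ℝ * (⅟₁₂ * ⅟₁₂) ≡ x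
    *144*⅟₁₂²≡ x = begin
      x * 144 · 1ℝ * (⅟₁₂ * ⅟₁₂)        ≡⟨ solve 2 (λ x i → x :* κ 144 :* (i :* i) := x :* κ 12 :* i :* κ 12 :* i) refl x ⅟₁₂ ⟩
      x * 12 · 1ℝ * ⅟₁₂ * 12 · 1ℝ * ⅟₁₂  ≡⟨ cong (λ y → y * 12 · 1ℝ * ⅟₁₂) (*-cancelʳ (proj₂ ⅟₁₂-inverse)) ⟩
      x * 12 · 1ℝ * ⅟₁₂                 ≡⟨ *-cancelʳ (proj₂ ⅟₁₂-inverse) ⟩
      x                                 ∎

    scaledSqLength-correct : ∀ ℓ → ⟦ scaledSqLength ℓ ⟧ * (⅟₁₂ * ⅟₁₂) ≡ length ℓ * length ℓ
    scaledSqLength-correct unit = begin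
      ((144 · 1ℝ + 0 · 1ℝ * √3) + (0 · 1ℝ + 0 · 1ℝ * √3) * √11) * (⅟₁₂ * ⅟₁₂)
        ≡⟨ solve 3 (λ r w i → ((κ 144 :+ κ 0 :* r) :+ (κ 0 :+ κ 0 :* r) :* w) :* (i :* i)
                           := κ 1 :* κ 1 :* κ 144 :* (i :* i)) refl √3 √11 ⅟₁₂ ⟩
      1ℝ * 1ℝ * 144 · 1ℝ * (⅟₁₂ * ⅟₁₂)  ≡⟨ *144*⅟₁₂²≡ (1ℝ * 1ℝ) ⟩
      1ℝ * 1ℝ                           ∎
    scaledSqLength-correct long = begin
      ((216 · 1ℝ + 0 · 1ℝ * √3) + (0 · 1ℝ + 24 · 1ℝ * √3) * √11) * (⅟₁₂ * ⅟₁₂)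
        ≡⟨ solve 3 (λ r w i → ((κ 216 :+ κ 0 :* r) :+ (κ 0 :+ κ 24 :* r) :* w) :* (i :* i)
                           := κ 24 :* (κ 9 :+ r :* w) :* (i :* i)) refl √3 √11 ⅟₁₂ ⟩
      24 · 1ℝ * (9 · 1ℝ + √3 * √11) * (⅟₁₂ * ⅟₁₂)
        ≡⟨ cong (λ x → 24 · 1ℝ * (9 · 1ℝ + x) * (⅟₁₂ * ⅟₁₂)) √3*√11≡s ⟩
      24 · 1ℝ * (9 · 1ℝ + s) * (⅟₁₂ * ⅟₁₂)
        ≡⟨ cong (λ x → 24 · 1ℝ * x * (⅟₁₂ * ⅟₁₂)) 9+s≡6t² ⟩
      24 · 1ℝ * (6 · 1ℝ * (t * t)) * (⅟₁₂ * ⅟₁₂)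
        ≡⟨ solve 2 (λ t i → κ 24 :* (κ 6 :* (t :* t)) :* (i :* i) := t :* t :* κ 144 :* (i :* i)) refl t ⅟₁₂ ⟩
      t * t * 144 · 1ℝ * (⅟₁₂ * ⅟₁₂)    ≡⟨ *144*⅟₁₂²≡ (t * t) ⟩
      t * t                             ∎
      where
      9+s≡6t² : 9 · 1ℝ + s ≡ 6 · 1ℝ * (t * t)
      9+s≡6t² = begin
        9 · 1ℝ + s          ≡⟨ cong (_+ s) (fromℕ≡n·1 9) ⟨
        fromℕ 9 + s         ≡⟨ 6t²≡9+s ⟨
        fromℕ 6 * (t * t)   ≡⟨ cong (_* (t * t)) (fromℕ≡n·1 6) ⟩
        6 · 1ℝ * (t * t)    ∎

    |vertex1-vertex21|²≡4 : sqDist (vertex 1) (vertex 21) ≡ 4 · 1ℝ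
    |vertex1-vertex21|²≡4 = begin
      sqDist (vertex 1) (vertex 21)
        ≡⟨ sqDist-embed ℚ[√3,√11] ⅟₁₂ (position 1) (position 21) ⟩
      ((576 · 1ℝ + 0 · 1ℝ * √3) + (0 · 1ℝ + 0 · 1ℝ * √3) * √11) * (⅟₁₂ * ⅟₁₂)
        ≡⟨ solve 3 (λ r w i → ((κ 576 :+ κ 0 :* r) :+ (κ 0 :+ κ 0 :* r) :* w) :* (i :* i)
                           := κ 4 :* κ 144 :* (i :* i)) refl √3 √11 ⅟₁₂ ⟩
      4 · 1ℝ * 144 · 1ℝ * (⅟₁₂ * ⅟₁₂)
        ≡⟨ *144*⅟₁₂²≡ (4 · 1ℝ) ⟩
      4 · 1ℝ ∎

    module _ (c : E² → Fin 4) (proper : ∀ p q → Adjacent D p q → c p ≢ c q) where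

      distance-2-monochromatic : ∀ p q → sqDist q p ≡ 4 · 1ℝ → c p ≡ c q
      distance-2-monochromatic p q |q-p|²≡4 =
        subst₂ (λ x y → c x ≡ c y) M-vertex21≡p M-vertex1≡q
          (uncolourable-addEdge⇒sameColour 21 1 gadget gadget-forces
            (EdgesSatisfy⇒Proper f edge-coloured 0 gadgetEdges gadget-lengths))
        where
        motion : Σ (E² → E²) λ M → IsIsometry M × M (vertex 21) ≡ p × M (vertex 1) ≡ q
        motion = segment-congruence (vertex 21) (vertex 1) p q |vertex1-vertex21|²≡4 |q-p|²≡4
                                    (proj₂ (inverse (4 · 1ℝ) (n·1≢0 4)))
        M : E² → E²
        M = proj₁ motion
        M-vertex21≡p : M (vertex 21) ≡ p
        M-vertex21≡p = proj₁ (proj₂ (proj₂ motion))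
        M-vertex1≡q : M (vertex 1) ≡ q
        M-vertex1≡q = proj₂ (proj₂ (proj₂ motion))
        f : ℕ → Fin 4
        f i = c (M (vertex i))
        open Colouring f
        edge-coloured : ∀ i j ℓ → HasLength i j ℓ → f i ≢ f j
        edge-coloured i j ℓ hasLength = proper (M (vertex i)) (M (vertex j)) (adjacent (D-length ℓ) (0≤length ℓ) (begin
          sqDist (M (vertex i)) (M (vertex j))
            ≡⟨ proj₁ (proj₂ motion) (vertex i) (vertex j) ⟩
          sqDist (vertex i) (vertex j)
            ≡⟨ sqDist-embed ℚ[√3,√11] ⅟₁₂ (position i) (position j) ⟩
          ⟦ Plane.sqDist ℤ[√3,√11] (position i) (position j) ⟧ * (⅟₁₂ * ⅟₁₂)
            ≡⟨ cong (λ x → ⟦ x ⟧ * (⅟₁₂ * ⅟₁₂)) hasLength ⟩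
          ⟦ scaledSqLength ℓ ⟧ * (⅟₁₂ * ⅟₁₂)
            ≡⟨ scaledSqLength-correct ℓ ⟩
          length ℓ * length ℓ ∎))

      no-proper-4-colouring : ⊥
      no-proper-4-colouring = proper x y (adjacent (inj₁ refl) 0≤1 |x-y|²≡1) (trans (sym c-o≡c-x) c-o≡c-y)
        where
        √15-root : ∃ λ x → 0ℝ ≤ x × x * x ≡ 15 · 1ℝ
        √15-root = sqrt (15 · 1ℝ) (0≤n·1 15) (n·1≢0 15)
        ¼-inverse : ∃ λ x → 4 · 1ℝ * x ≡ 1ℝ
        ¼-inverse = inverse (4 · 1ℝ) (n·1≢0 4)
        √15 ¼ : ℝ
        √15 = proj₁ √15-root
        ¼ = proj₁ ¼-inverse

        o x y : E²
        o = 0ℝ , 0ℝ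
        x = 2 · 1ℝ , 0ℝ
        y = 7 · 1ℝ * ¼ , √15 * ¼

        *16*¼²≡ : ∀ z → z * 16 · 1ℝ * (¼ * ¼) ≡ z
        *16*¼²≡ z = begin
          z * 16 · 1ℝ * (¼ * ¼)          ≡⟨ solve 2 (λ z i → z :* κ 16 :* (i :* i) := z :* κ 4 :* i :* κ 4 :* i) refl z ¼ ⟩
          z * 4 · 1ℝ * ¼ * 4 · 1ℝ * ¼    ≡⟨ cong (λ w → w * 4 · 1ℝ * ¼) (*-cancelʳ (proj₂ ¼-inverse)) ⟩
          z * 4 · 1ℝ * ¼                 ≡⟨ *-cancelʳ (proj₂ ¼-inverse) ⟩
          z                              ∎

        |x-o|²≡4 : sqDist x o ≡ 4 · 1ℝ
        |x-o|²≡4 = solve 0 ((κ 2 :- κ 0) :* (κ 2 :- κ 0) :+ (κ 0 :- κ 0) :* (κ 0 :- κ 0) := κ 4) refl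

        |y-o|²≡4 : sqDist y o ≡ 4 · 1ℝ
        |y-o|²≡4 = begin
          sqDist y o
            ≡⟨ solve 2 (λ w i → (κ 7 :* i :- κ 0) :* (κ 7 :* i :- κ 0) :+ (w :* i :- κ 0) :* (w :* i :- κ 0)
                             := (κ 49 :+ w :* w) :* (i :* i)) refl √15 ¼ ⟩
          (49 · 1ℝ + √15 * √15) * (¼ * ¼)
            ≡⟨ cong (λ z → (49 · 1ℝ + z) * (¼ * ¼)) (proj₂ (proj₂ √15-root)) ⟩
          (49 · 1ℝ + 15 · 1ℝ) * (¼ * ¼)
            ≡⟨ solve 1 (λ i → (κ 49 :+ κ 15) :* (i :* i) := κ 4 :* κ 16 :* (i :* i)) refl ¼ ⟩
          4 · 1ℝ * 16 · 1ℝ * (¼ * ¼)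
            ≡⟨ *16*¼²≡ (4 · 1ℝ) ⟩
          4 · 1ℝ ∎

        |x-y|²≡1 : sqDist x y ≡ 1ℝ * 1ℝ
        |x-y|²≡1 = begin
          sqDist x y
            ≡⟨ solve 2 (λ w i → (κ 2 :- κ 7 :* i) :* (κ 2 :- κ 7 :* i) :+ (κ 0 :- w :* i) :* (κ 0 :- w :* i)
                             := κ 4 :- κ 7 :* (κ 4 :* i) :+ (κ 49 :+ w :* w) :* (i :* i)) refl √15 ¼ ⟩
          4 · 1ℝ - 7 · 1ℝ * (4 · 1ℝ * ¼) + (49 · 1ℝ + √15 * √15) * (¼ * ¼)
            ≡⟨ cong₂ (λ u z → 4 · 1ℝ - 7 · 1ℝ * u + (49 · 1ℝ + z) * (¼ * ¼)) (proj₂ ¼-inverse) (proj₂ (proj₂ √15-root)) ⟩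
          4 · 1ℝ - 7 · 1ℝ * 1ℝ + (49 · 1ℝ + 15 · 1ℝ) * (¼ * ¼)
            ≡⟨ solve 1 (λ i → κ 4 :- κ 7 :* κ 1 :+ (κ 49 :+ κ 15) :* (i :* i)
                             := κ 1 :* κ 1 :- κ 4 :+ κ 4 :* κ 16 :* (i :* i)) refl ¼ ⟩
          1ℝ * 1ℝ - 4 · 1ℝ + 4 · 1ℝ * 16 · 1ℝ * (¼ * ¼)
            ≡⟨ cong (1ℝ * 1ℝ - 4 · 1ℝ +_) (*16*¼²≡ (4 · 1ℝ)) ⟩
          1ℝ * 1ℝ - 4 · 1ℝ + 4 · 1ℝ
            ≡⟨ solve 0 (κ 1 :* κ 1 :- κ 4 :+ κ 4 := κ 1 :* κ 1) refl ⟩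
          1ℝ * 1ℝ ∎

        c-o≡c-x : c o ≡ c x
        c-o≡c-x = distance-2-monochromatic o x |x-o|²≡4

        c-o≡c-y : c o ≡ c y
        c-o≡c-y = distance-2-monochromatic o y |y-o|²≡4

mainTheorem8 : (R : RealNumbers) → let open RealNumbers R in
    (s t : ℝ) →
    -- s = √33
    0ℝ ≤ s → s * s ≡ fromℕ 33 →
    -- t = √(3/2 + √33/6), i.e. t ≥ 0 and 6 t² = 9 + √33
    0ℝ ≤ t → fromℕ 6 * (t * t) ≡ fromℕ 9 + s →
    χ≥ (λ d → d ≡ 1ℝ ⊎ d ≡ t) 5
-- The sign of s is irrelevant: the construction only uses s² = 33.
mainTheorem8 R s t _ s*s≡33 0≤t 6t²≡9+s k k<5 (c , proper) =
  Real.Realisation.no-proper-4-colouring R s t s*s≡33 0≤t 6t²≡9+s c₄ proper₄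
  where
  open RealNumbers R using (E²; Adjacent; 1ℝ)
  k≤4 : k ℕ.≤ 4
  k≤4 = ℕ.≤-pred k<5
  c₄ : E² → Fin 4
  c₄ p = Fin.inject≤ (c p) k≤4
  proper₄ : ∀ p q → Adjacent (λ d → d ≡ 1ℝ ⊎ d ≡ t) p q → c₄ p ≢ c₄ q
  proper₄ p q adjacent = proper p q adjacent ∘ inject≤-injective k≤4 k≤4 (c p) (c q)
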